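{- For $p=3$ and all $L\ge 0$, \[a_{\mathrm{dbl}}(L)=F(2L+2)=U_L(3/2),\] where $F$ is the Fibonacci sequence ($F(1)=F(2)=1$) and $U_L$ is the Chebyshev polynomial of the second kind.
   Context: For a digit string $(d_1,\dots,d_L)\in\{0,1,2\}^L$ (the base-$3$ digits of $m\in[0,3^L)$, least significant first), set $\sigma_0=0$, $\sigma_j=\lfloor(2d_j+\sigma_{j-1})/3\rfloor$. The string (the doubling of $m$) is cascade-free if there is no $j$ with $2d_j=2$ (i.e. $d_j=1$) and $\sigma_{j-1}=1$. $a_{\mathrm{dbl}}(L)$ is the number of cascade-free strings of length $L$. Chebyshev polynomials of the second kind: $U_0=1$, $U_1(x)=2x$, $U_n(x)=2xU_{n-1}(x)-U_{n-2}(x)$. -}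

module Defs where

open import Data.Nat using (ℕ; zero; suc; _+_; _*_; _/_)
open import Data.Bool using (Bool; true; false; _∧_; not)
open import Data.Fin using (Fin; toℕ)
open import Data.Fin.Base using () renaming (zero to fz; suc to fs)
open import Data.Vec using (Vec; []; _∷_)
open import Data.List using (List; []; _∷_; concatMap; map; filter; length)
open import Data.Nat using (_≡ᵇ_)
import Data.Rational as ℚ
import Data.Integer as ℤ
open import Data.Rational using (ℚ)

digits3 : List (Fin 3)
digits3 = fz ∷ fs fz ∷ fs (fs fz) ∷ []

-- all digit strings of length L (digit d_1 is the head, least significant first)
allStrings : (L : ℕ) → List (Vec (Fin 3) L)
allStrings zero = [] ∷ []
allStrings (suc L) = concatMap (λ d → map (d ∷_) (allStrings L)) digits3

-- cascade-free check given the incoming carry σ_{j-1}: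
-- σ_j = ⌊(2 d_j + σ_{j-1}) / 3⌋; failure iff d_j = 1 and σ_{j-1} = 1
cfFrom : ∀ {L} → ℕ → Vec (Fin 3) L → Bool
cfFrom σ [] = true
cfFrom σ (d ∷ ds) =
  not ((toℕ d ≡ᵇ 1) ∧ (σ ≡ᵇ 1)) ∧ cfFrom ((2 * toℕ d + σ) / 3) ds

cascadeFree : ∀ {L} → Vec (Fin 3) L → Bool
cascadeFree = cfFrom 0

aDbl : ℕ → ℕ
aDbl L = length (filter (λ v → cascadeFree v Data.Bool.≟ true) (allStrings L))

fib : ℕ → ℕ
fib zero = 0
fib (suc zero) = 1
fib (suc (suc n)) = fib (suc n) + fib n

chebU : ℕ → ℚ → ℚ
chebU zero x = ℚ.1ℚ
chebU (suc zero) x = ((ℤ.+ 2) ℚ./ 1) ℚ.* x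
chebU (suc (suc n)) x = ((ℤ.+ 2) ℚ./ 1) ℚ.* x ℚ.* chebU (suc n) x ℚ.- chebU n x

threeHalves : ℚ
threeHalves = (ℤ.+ 3) ℚ./ 2

-- Let c σ L count the strings of length L that are cascade-free when started with carry σ.
-- Splitting off the first digit gives c 1 (L+1) = c 0 L + c 1 L and
-- c 0 (L+1) = 2 c 0 L + c 1 L = c 1 (L+1) + c 0 L, so the interleaved sequence
-- c 1 0, c 0 0, c 1 1, c 0 1, ... obeys the Fibonacci recurrence from F(1), F(2).
-- The even-indexed Fibonacci numbers satisfy F(n+4) = 3 F(n+2) - F(n), which is the
-- recurrence U(n+2) = 2 (3/2) U(n+1) - U(n) with the same initial values 1 and 3.
module Submission where

open import Defs
import Algebra.Properties.Group as GroupProperties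
open import Data.Bool using (true; false; _≟_)
open import Data.Fin using (Fin)
open import Data.Integer using (+_)
import Data.Integer as ℤ
import Data.Integer.Properties as ℤ
open import Data.List using (List; []; _∷_; _++_; map; concatMap; filter; length)
open import Data.List.Properties using (length-++; filter-++; filter-none; map-cong)
open import Data.List.Relation.Unary.All using (universal)
open import Data.Nat using (ℕ; zero; suc; _+_; _*_)
open import Data.Nat.ListAction using (sum)
open import Data.Nat.Properties using (+-comm; +-identityʳ; *-suc; *-distribˡ-+)
open import Data.Nat.Tactic.RingSolver using (solve-∀)
open import Data.Product using (_×_; _,_; proj₂)
open import Data.Rational using (ℚ; _/_; toℚᵘ)
import Data.Rational as ℚ
import Data.Rational.Properties as ℚ
open import Data.Rational.Unnormalised using (mkℚᵘ; *≡*; _≃_)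
import Data.Rational.Unnormalised as ℚᵘ
import Data.Rational.Unnormalised.Properties as ℚᵘ
open import Data.Vec using (Vec; _∷_)
open import Function using (_∘_)
open import Relation.Binary.PropositionalEquality
  using (_≡_; refl; sym; trans; cong; cong₂; module ≡-Reasoning)
open import Relation.Nullary using (does)
open import Relation.Unary using (Pred; Decidable)

module _ {a b p} {A : Set a} {B : Set b} {P : Pred B p} (P? : Decidable P) where
  open ≡-Reasoning

  length-filter-map : ∀ (f : A → B) xs →
                      length (filter P? (map f xs)) ≡ length (filter (P? ∘ f) xs)
  length-filter-map f []       = refl
  length-filter-map f (x ∷ xs) with does (P? (f x))
  ... | true  = cong suc (length-filter-map f xs)
  ... | false = length-filter-map f xs

  length-filter-concatMap : ∀ (f : A → List B) xs →
                            length (filter P? (concatMap f xs)) ≡ sum (map (length ∘ filter P? ∘ f) xs)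
  length-filter-concatMap f []       = refl
  length-filter-concatMap f (x ∷ xs) = begin
    length (filter P? (f x ++ concatMap f xs))
      ≡⟨ cong length (filter-++ P? (f x) _) ⟩
    length (filter P? (f x) ++ filter P? (concatMap f xs))
      ≡⟨ length-++ (filter P? (f x)) ⟩
    length (filter P? (f x)) + length (filter P? (concatMap f xs))
      ≡⟨ cong₂ _+_ refl (length-filter-concatMap f xs) ⟩
    length (filter P? (f x)) + sum (map (length ∘ filter P? ∘ f) xs) ∎

length-filter-allStrings-suc : ∀ {p L} {P : Pred (Vec (Fin 3) (suc L)) p} (P? : Decidable P) →
  length (filter P? (allStrings (suc L))) ≡
  sum (map (λ d → length (filter (P? ∘ (d ∷_)) (allStrings L))) digits3)
length-filter-allStrings-suc {L = L} P? =
  trans (length-filter-concatMap P? (λ d → map (d ∷_) (allStrings L)) digits3)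
        (cong sum (map-cong (λ d → length-filter-map P? (d ∷_) (allStrings L)) digits3))

cfCount : ℕ → ℕ → ℕ
cfCount σ L = length (filter (λ v → cfFrom σ v ≟ true) (allStrings L))

-- A leading digit d turns carry σ into ⌊(2d+σ)/3⌋: from carry 0 the digits 0, 1, 2 lead to
-- carries 0, 0, 1; from carry 1 the digit 1 is rejected and the digits 0, 2 lead to carries 0, 1.
cfCount-1-suc : ∀ L → cfCount 1 (suc L) ≡ cfCount 0 L + cfCount 1 L
cfCount-1-suc L = begin
  cfCount 1 (suc L)
    ≡⟨ length-filter-allStrings-suc {L = L} (λ v → cfFrom 1 v ≟ true) ⟩
  cfCount 0 L + (length (filter (λ _ → false ≟ true) (allStrings L)) + (cfCount 1 L + 0))
    ≡⟨ cong (λ r → cfCount 0 L + (length r + (cfCount 1 L + 0)))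
            (filter-none (λ _ → false ≟ true) (universal (λ _ ()) (allStrings L))) ⟩
  cfCount 0 L + (cfCount 1 L + 0)
    ≡⟨ cong₂ _+_ refl (+-identityʳ (cfCount 1 L)) ⟩
  cfCount 0 L + cfCount 1 L ∎
  where open ≡-Reasoning

cfCount-0-suc : ∀ L → cfCount 0 (suc L) ≡ cfCount 1 (suc L) + cfCount 0 L
cfCount-0-suc L = begin
  cfCount 0 (suc L)
    ≡⟨ length-filter-allStrings-suc {L = L} (λ v → cfFrom 0 v ≟ true) ⟩
  cfCount 0 L + (cfCount 0 L + (cfCount 1 L + 0))
    ≡⟨ cong (λ t → cfCount 0 L + (cfCount 0 L + t)) (+-identityʳ _) ⟩
  cfCount 0 L + (cfCount 0 L + cfCount 1 L)
    ≡⟨ +-comm (cfCount 0 L) _ ⟩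
  cfCount 0 L + cfCount 1 L + cfCount 0 L
    ≡⟨ cong₂ _+_ (sym (cfCount-1-suc L)) refl ⟩
  cfCount 1 (suc L) + cfCount 0 L ∎
  where open ≡-Reasoning

cfCount-fib : ∀ L → cfCount 1 L ≡ fib (1 + 2 * L) × cfCount 0 L ≡ fib (2 + 2 * L)
cfCount-fib zero = refl , refl
cfCount-fib (suc L) with cfCount-fib L
... | c₁≡fib , c₀≡fib = c₁'≡fib , c₀'≡fib
  where
  open ≡-Reasoning

  fib-2*suc : ∀ k → fib (k + 2 * suc L) ≡ fib (k + (2 + 2 * L))
  fib-2*suc k = cong (λ m → fib (k + m)) (*-suc 2 L)

  c₁'≡fib : cfCount 1 (suc L) ≡ fib (1 + 2 * suc L)
  c₁'≡fib = begin
    cfCount 1 (suc L)         ≡⟨ cfCount-1-suc L ⟩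
    cfCount 0 L + cfCount 1 L ≡⟨ cong₂ _+_ c₀≡fib c₁≡fib ⟩
    fib (3 + 2 * L)           ≡⟨ fib-2*suc 1 ⟨
    fib (1 + 2 * suc L)       ∎

  c₀'≡fib : cfCount 0 (suc L) ≡ fib (2 + 2 * suc L)
  c₀'≡fib = begin
    cfCount 0 (suc L)                     ≡⟨ cfCount-0-suc L ⟩
    cfCount 1 (suc L) + cfCount 0 L       ≡⟨ cong₂ _+_ c₁'≡fib c₀≡fib ⟩
    fib (1 + 2 * suc L) + fib (2 + 2 * L) ≡⟨ cong₂ _+_ (fib-2*suc 1) refl ⟩
    fib (4 + 2 * L)                       ≡⟨ fib-2*suc 2 ⟨
    fib (2 + 2 * suc L)                   ∎

fib-bisection-recurrence : ∀ n → fib (4 + n) + fib n ≡ 3 * fib (2 + n)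
fib-bisection-recurrence n = unfolded (fib (1 + n)) (fib n)
  where
  unfolded : ∀ x y → x + y + x + (x + y) + y ≡ 3 * (x + y)
  unfolded = solve-∀

fib-even-recurrence : ∀ n → fib (2 + 2 * (2 + n)) + fib (2 + 2 * n) ≡ 3 * fib (2 + 2 * (1 + n))
fib-even-recurrence n = begin
  fib (2 + 2 * (2 + n)) + fib (2 + 2 * n)
    ≡⟨ cong (λ m → fib (2 + m) + fib (2 + 2 * n)) (*-distribˡ-+ 2 2 n) ⟩
  fib (4 + (2 + 2 * n)) + fib (2 + 2 * n)
    ≡⟨ fib-bisection-recurrence (2 + 2 * n) ⟩
  3 * fib (2 + (2 + 2 * n))
    ≡⟨ cong (λ m → 3 * fib (2 + m)) (*-distribˡ-+ 2 1 n) ⟨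
  3 * fib (2 + 2 * (1 + n)) ∎
  where open ≡-Reasoning

fromℕ : ℕ → ℚ
fromℕ n = + n / 1

toℚᵘ-fromℕ : ∀ n → toℚᵘ (fromℕ n) ≃ mkℚᵘ (+ n) 0
toℚᵘ-fromℕ n = ℚ.toℚᵘ-fromℚᵘ (mkℚᵘ (+ n) 0)

fromℕ-homo-+ : ∀ m n → fromℕ (m + n) ≡ fromℕ m ℚ.+ fromℕ n
fromℕ-homo-+ m n = ℚ.toℚᵘ-injective (begin
  toℚᵘ (fromℕ (m + n))               ≈⟨ toℚᵘ-fromℕ (m + n) ⟩
  mkℚᵘ (+ (m + n)) 0                 ≈⟨ *≡* (cong₂ ℤ._*_ sum≡ refl) ⟩
  mkℚᵘ (+ m) 0 ℚᵘ.+ mkℚᵘ (+ n) 0     ≈⟨ ℚᵘ.+-cong (toℚᵘ-fromℕ m) (toℚᵘ-fromℕ n) ⟨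
  toℚᵘ (fromℕ m) ℚᵘ.+ toℚᵘ (fromℕ n) ≈⟨ ℚ.toℚᵘ-homo-+ (fromℕ m) (fromℕ n) ⟨
  toℚᵘ (fromℕ m ℚ.+ fromℕ n)         ∎)
  where
  open ℚᵘ.≃-Reasoning
  sum≡ : + (m + n) ≡ + m ℤ.* + 1 ℤ.+ + n ℤ.* + 1
  sum≡ = trans (ℤ.pos-+ m n) (sym (cong₂ ℤ._+_ (ℤ.*-identityʳ (+ m)) (ℤ.*-identityʳ (+ n))))

fromℕ-homo-* : ∀ m n → fromℕ (m * n) ≡ fromℕ m ℚ.* fromℕ n
fromℕ-homo-* m n = ℚ.toℚᵘ-injective (begin
  toℚᵘ (fromℕ (m * n))               ≈⟨ toℚᵘ-fromℕ (m * n) ⟩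
  mkℚᵘ (+ (m * n)) 0                 ≡⟨ cong (λ i → mkℚᵘ i 0) (ℤ.pos-* m n) ⟩
  mkℚᵘ (+ m) 0 ℚᵘ.* mkℚᵘ (+ n) 0     ≈⟨ ℚᵘ.*-cong (toℚᵘ-fromℕ m) (toℚᵘ-fromℕ n) ⟨
  toℚᵘ (fromℕ m) ℚᵘ.* toℚᵘ (fromℕ n) ≈⟨ ℚ.toℚᵘ-homo-* (fromℕ m) (fromℕ n) ⟨
  toℚᵘ (fromℕ m ℚ.* fromℕ n)         ∎)
  where open ℚᵘ.≃-Reasoning

m+n≡o⇒fromℕm≡fromℕo-fromℕn : ∀ {m n o} → m + n ≡ o → fromℕ m ≡ fromℕ o ℚ.- fromℕ n
m+n≡o⇒fromℕm≡fromℕo-fromℕn {m} {n} {o} m+n≡o = begin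
  fromℕ m                         ≡⟨ //-rightDividesʳ (fromℕ n) (fromℕ m) ⟨
  fromℕ m ℚ.+ fromℕ n ℚ.- fromℕ n ≡⟨ cong (ℚ._- fromℕ n) (fromℕ-homo-+ m n) ⟨
  fromℕ (m + n) ℚ.- fromℕ n       ≡⟨ cong (λ o → fromℕ o ℚ.- fromℕ n) m+n≡o ⟩
  fromℕ o ℚ.- fromℕ n             ∎
  where
  open ≡-Reasoning
  open GroupProperties ℚ.+-0-group using (//-rightDividesʳ)

recurrence⇒fromℕ≡chebU : ∀ {x} k → fromℕ 2 ℚ.* x ≡ fromℕ k → (s : ℕ → ℕ) →
  s 0 ≡ 1 → s 1 ≡ k → (∀ n → s (2 + n) + s n ≡ k * s (1 + n)) →
  ∀ n → fromℕ (s n) ≡ chebU n x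
recurrence⇒fromℕ≡chebU {x} k 2x≡k s s₀≡1 s₁≡k recurrence = go
  where
  open ≡-Reasoning

  go : ∀ n → fromℕ (s n) ≡ chebU n x
  go zero          = cong fromℕ s₀≡1
  go (suc zero)    = trans (cong fromℕ s₁≡k) (sym 2x≡k)
  go (suc (suc n)) = begin
    fromℕ (s (2 + n))
      ≡⟨ m+n≡o⇒fromℕm≡fromℕo-fromℕn {s (2 + n)} {s n} (recurrence n) ⟩
    fromℕ (k * s (1 + n)) ℚ.- fromℕ (s n)
      ≡⟨ cong (ℚ._- fromℕ (s n)) (fromℕ-homo-* k (s (1 + n))) ⟩
    fromℕ k ℚ.* fromℕ (s (1 + n)) ℚ.- fromℕ (s n)
      ≡⟨ cong₂ ℚ._-_ (cong₂ ℚ._*_ (sym 2x≡k) (go (suc n))) (go n) ⟩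
    chebU (2 + n) x ∎

theorem5p5 : (L : ℕ) → (aDbl L ≡ fib (2 * L + 2)) × ((+ fib (2 * L + 2)) / 1 ≡ chebU L threeHalves)
theorem5p5 L rewrite +-comm (2 * L) 2 =
    proj₂ (cfCount-fib L)
  , recurrence⇒fromℕ≡chebU 3 refl (λ n → fib (2 + 2 * n)) refl refl fib-even-recurrence L
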